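{- Let $\mathcal{K}$ be the class of all finite undirected simple acyclic graphs (finite forests) in which every vertex carries exactly one label from $\mathbb{Z}/5\mathbb{Z}$, such that no vertex with label $i$ has both a neighbor with label $i+1$ and a neighbor with label $i+2$ (addition modulo $5$). Then $\mathcal{K}$ does not have the cofinal amalgamation property.
   Context: Vertex-labeled graphs are regarded as relational structures (edge relation plus one unary predicate per label); an embedding is an injective map preserving and reflecting adjacency and preserving labels (i.e. an isomorphism onto an induced labeled subgraph). A class $\mathcal{F}$ of finite structures has the cofinal amalgamation property (CAP) if for every $Z\in\mathcal{F}$ there is $Z'\in\mathcal{F}$ containing $Z$ as a substructure such that for all embeddings $f\colon Z'\to X$, $g\colon Z'\to Y$ with $X,Y\in\mathcal{F}$ there exist $W\in\mathcal{F}$ and embeddings $f'\colon X\to W$, $g'\colon Y\to W$ with $f'\circ f=g'\circ g$. -}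

module Defs where

open import Data.Nat using (ℕ; zero; suc)
open import Data.Fin using (Fin; zero; suc; inject₁; fromℕ)
open import Data.Bool using (Bool; true; false)
open import Data.Product using (Σ; _×_; ∃-syntax)
open import Data.Empty using (⊥)
open import Relation.Nullary using (¬_)
open import Relation.Binary.PropositionalEquality using (_≡_)
open import Function.Definitions using (Injective)

succ5 : Fin 5 → Fin 5
succ5 zero = suc zero
succ5 (suc zero) = suc (suc zero)
succ5 (suc (suc zero)) = suc (suc (suc zero))
succ5 (suc (suc (suc zero))) = suc (suc (suc (suc zero)))
succ5 (suc (suc (suc (suc zero)))) = zero

record LGraph : Set where
  field
    size   : ℕ
    adj    : Fin size → Fin size → Bool
    symm   : ∀ i j → adj i j ≡ adj j i
    irrefl : ∀ i → adj i i ≡ false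
    label  : Fin size → Fin 5
open LGraph public

-- A cycle of length m + 3: injective closed walk v₀ v₁ … v_{m+2} v₀.
record Cycle (G : LGraph) : Set where
  field
    len    : ℕ
    vert   : Fin (suc (suc (suc len))) → Fin (size G)
    inj    : Injective _≡_ _≡_ vert
    step   : ∀ (i : Fin (suc (suc len))) → adj G (vert (inject₁ i)) (vert (suc i)) ≡ true
    close  : adj G (vert (fromℕ (suc (suc len)))) (vert zero) ≡ true

Acyclic : LGraph → Set
Acyclic G = ¬ Cycle G

LabelCond : LGraph → Set
LabelCond G = ∀ v u w → adj G v u ≡ true → adj G v w ≡ true →
  label G u ≡ succ5 (label G v) → label G w ≡ succ5 (succ5 (label G v)) → ⊥

InK : LGraph → Set
InK G = Acyclic G × LabelCond G

record Emb (G H : LGraph) : Set where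
  field
    map   : Fin (size G) → Fin (size H)
    inj   : Injective _≡_ _≡_ map
    adjP  : ∀ i j → adj H (map i) (map j) ≡ adj G i j
    labP  : ∀ i → label H (map i) ≡ label G i
open Emb public

CAP : (LGraph → Set) → Set
CAP 𝓕 = ∀ Z → 𝓕 Z → Σ LGraph λ Z' → 𝓕 Z' × Emb Z Z' ×
  (∀ X Y → 𝓕 X → 𝓕 Y → (f : Emb Z' X) (g : Emb Z' Y) →
    Σ LGraph λ W → 𝓕 W × Σ (Emb X W) λ f' → Σ (Emb Y W) λ g' →
      ∀ z → map f' (map f z) ≡ map g' (map g z))

module Submission where

-- Let Z' ∈ 𝒦 be a CAP witness over the one-point graph. Some vertex v of Z' is
-- free: it has no neighbour labelled v+1 or v+2. Otherwise following such
-- neighbours gives an infinite walk that never backtracks (two increments of 1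
-- or 2 never sum to 0 mod 5), and a non-backtracking walk in a finite forest
-- cannot exist. Hanging a new leaf labelled v+1, resp. v+2, at the free vertex v
-- gives two members of 𝒦 containing Z'; in any amalgam the image of v would have
-- neighbours of both labels.

open import Defs
open import Data.Nat using (ℕ; zero; suc; _+_; _∸_; _≤_; z≤n)
open import Data.Nat.Properties
  using (≤-refl; ≤-pred; m≤n⇒m<n∨m≡n; m∸n+n≡m; +-monoˡ-≤; +-cancelʳ-≡; m≢1+n+m)
open import Data.Fin using (Fin; zero; suc; inject₁; fromℕ; toℕ; _≟_)
open import Data.Fin.Properties
  using (toℕ-injective; toℕ-inject₁; toℕ-fromℕ; toℕ≤pred[n]; suc-injective; 0≢1+n; any?; ¬∀⟶∃¬; <⇒notInjective)
open import Data.Fin.Relation.Unary.Top using (view; ‵fromℕ; ‵inject₁)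
open import Data.Bool using (Bool; true; false) renaming (_≟_ to _≟ᵇ_)
open import Data.Product using (_×_; _,_; proj₁; proj₂; ∃-syntax; ∃₂)
open import Data.Sum using (_⊎_; inj₁; inj₂)
open import Data.Empty using (⊥; ⊥-elim)
open import Function using (_∘_)
open import Function.Definitions using (Injective)
open import Relation.Nullary using (¬_; Dec; yes; does)
open import Relation.Nullary.Decidable using (dec-true; _×-dec_; _⊎-dec_)
open import Relation.Binary.PropositionalEquality

dec-true⁻¹ : ∀ {a} {A : Set a} (a? : Dec A) → does a? ≡ true → A
dec-true⁻¹ (yes a) _ = a

adj-sym : ∀ {G : LGraph} {a b} → adj G a b ≡ true → adj G b a ≡ true
adj-sym {G} {a} {b} e = trans (symm G b a) e

_↝_ : Fin 5 → Fin 5 → Set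
a ↝ b = b ≡ succ5 a ⊎ b ≡ succ5 (succ5 a)

succ5≢succ5² : ∀ a → succ5 a ≢ succ5 (succ5 a)
succ5≢succ5² zero ()
succ5≢succ5² (suc zero) ()
succ5≢succ5² (suc (suc zero)) ()
succ5≢succ5² (suc (suc (suc zero))) ()
succ5≢succ5² (suc (suc (suc (suc zero)))) ()

succ5²≢id : ∀ a → succ5 (succ5 a) ≢ a
succ5²≢id zero ()
succ5²≢id (suc zero) ()
succ5²≢id (suc (suc zero)) ()
succ5²≢id (suc (suc (suc zero))) ()
succ5²≢id (suc (suc (suc (suc zero)))) ()

succ5³≢id : ∀ a → succ5 (succ5 (succ5 a)) ≢ a
succ5³≢id zero ()
succ5³≢id (suc zero) ()
succ5³≢id (suc (suc zero)) ()
succ5³≢id (suc (suc (suc zero))) ()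
succ5³≢id (suc (suc (suc (suc zero)))) ()

succ5⁴≢id : ∀ a → succ5 (succ5 (succ5 (succ5 a))) ≢ a
succ5⁴≢id zero ()
succ5⁴≢id (suc zero) ()
succ5⁴≢id (suc (suc zero)) ()
succ5⁴≢id (suc (suc (suc zero))) ()
succ5⁴≢id (suc (suc (suc (suc zero)))) ()

↝-noReturn : ∀ {a b c} → a ↝ b → b ↝ c → c ≢ a
↝-noReturn {a} (inj₁ refl) (inj₁ refl) = succ5²≢id a
↝-noReturn {a} (inj₁ refl) (inj₂ refl) = succ5³≢id a
↝-noReturn {a} (inj₂ refl) (inj₁ refl) = succ5³≢id a
↝-noReturn {a} (inj₂ refl) (inj₂ refl) = succ5⁴≢id a

module _ {G : LGraph} (C : Cycle G) where
  open Cycle C using (vert; step; close)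

  cycle-neighbours : ∀ p → ∃₂ λ a b →
    a ≢ b × adj G (vert p) (vert a) ≡ true × adj G (vert p) (vert b) ≡ true
  cycle-neighbours zero = suc zero , fromℕ _ , (λ ()) , step zero , adj-sym {G} close
  cycle-neighbours (suc q) with view q
  ... | ‵fromℕ = inject₁ q , zero , (λ ()) , adj-sym {G} (step q) , close
  ... | ‵inject₁ r = inject₁ q , suc (suc r) , pred≢succ , adj-sym {G} (step q) , step (suc r)
    where
    pred≢succ : inject₁ (inject₁ r) ≢ suc (suc r)
    pred≢succ e = m≢1+n+m (toℕ r)
      (trans (sym (trans (toℕ-inject₁ (inject₁ r)) (toℕ-inject₁ r))) (cong toℕ e))

  leaf-notOnCycle : ∀ x → (∀ u u′ → adj G x u ≡ true → adj G x u′ ≡ true → u ≡ u′) →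
    ∀ p → vert p ≢ x
  leaf-notOnCycle x unique p refl with cycle-neighbours p
  ... | a , b , a≢b , xa , xb = a≢b (Cycle.inj C (unique _ _ xa xb))

cycle-pullback : ∀ {G H} (e : Emb G H) (C : Cycle H) →
  (∀ i → ∃[ x ] map e x ≡ Cycle.vert C i) → Cycle G
cycle-pullback {G} {H} e C preimage = record
  { len = len ; vert = vert′ ; inj = inj′ ; step = λ i → reflect (step i) ; close = reflect close }
  where
  open Cycle C using (len; vert; step; close)
  vert′ : Fin (suc (suc (suc len))) → Fin (size G)
  vert′ i = proj₁ (preimage i)
  inj′ : Injective _≡_ _≡_ vert′
  inj′ {i} {j} e′ = Cycle.inj C (trans (sym (proj₂ (preimage i))) (trans (cong (map e) e′) (proj₂ (preimage j))))
  reflect : ∀ {i j} → adj H (vert i) (vert j) ≡ true → adj G (vert′ i) (vert′ j) ≡ true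
  reflect {i} {j} a =
    trans (sym (adjP e (vert′ i) (vert′ j))) (trans (cong₂ (adj H) (proj₂ (preimage i)) (proj₂ (preimage j))) a)

record NonBacktrackingWalk (G : LGraph) : Set where
  field
    vertex          : ℕ → Fin (size G)
    adjacent        : ∀ k → adj G (vertex k) (vertex (suc k)) ≡ true
    nonBacktracking : ∀ k → vertex (suc (suc k)) ≢ vertex k

module _ {G : LGraph} (acyclic : Acyclic G) (W : NonBacktrackingWalk G) where
  open NonBacktrackingWalk W

  InjectiveUpTo : ℕ → Set
  InjectiveUpTo n = ∀ {a b} → a ≤ n → b ≤ n → vertex a ≡ vertex b → a ≡ b

  cycleOfReturn : ∀ m j → InjectiveUpTo (suc (suc m) + j) →
    vertex (suc (suc (suc m) + j)) ≡ vertex j → Cycle G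
  cycleOfReturn m j injective return = record
    { len = m ; vert = vert ; inj = vert-injective ; step = step ; close = close }
    where
    vert : Fin (suc (suc (suc m))) → Fin (size G)
    vert i = vertex (toℕ i + j)
    vert-injective : Injective _≡_ _≡_ vert
    vert-injective {x} {y} e = toℕ-injective (+-cancelʳ-≡ j _ _
      (injective (+-monoˡ-≤ j (toℕ≤pred[n] x)) (+-monoˡ-≤ j (toℕ≤pred[n] y)) e))
    step : ∀ i → adj G (vert (inject₁ i)) (vert (suc i)) ≡ true
    step i = subst (λ k → adj G (vertex (k + j)) (vertex (suc (toℕ i + j))) ≡ true)
      (sym (toℕ-inject₁ i)) (adjacent (toℕ i + j))
    close : adj G (vert (fromℕ (suc (suc m)))) (vert zero) ≡ true
    close = subst₂ (λ k x → adj G (vertex (k + j)) x ≡ true)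
      (sym (toℕ-fromℕ (suc (suc m)))) return (adjacent (suc (suc m) + j))

  noReturn : ∀ o j {k} → o + j ≡ k → InjectiveUpTo k → vertex (suc k) ≢ vertex j
  noReturn zero j refl _ return =
    true≢false (trans (sym (adjacent j)) (trans (cong (adj G (vertex j)) return) (irrefl G (vertex j))))
    where
    true≢false : true ≢ false
    true≢false ()
  noReturn (suc zero) j refl _ = nonBacktracking j
  noReturn (suc (suc m)) j refl injective = acyclic ∘ cycleOfReturn m j injective

  returnFree : ∀ {n j} → InjectiveUpTo n → j ≤ n → vertex (suc n) ≢ vertex j
  returnFree {n} {j} injective j≤n = noReturn (n ∸ j) j (m∸n+n≡m j≤n) injective

  injectiveUpTo : ∀ n → InjectiveUpTo n
  injectiveUpTo zero z≤n z≤n _ = refl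
  injectiveUpTo (suc n) a≤ b≤ e with m≤n⇒m<n∨m≡n a≤ | m≤n⇒m<n∨m≡n b≤
  ... | inj₁ a< | inj₁ b< = injectiveUpTo n (≤-pred a<) (≤-pred b<) e
  ... | inj₂ refl | inj₂ refl = refl
  ... | inj₁ a< | inj₂ refl = ⊥-elim (returnFree (injectiveUpTo n) (≤-pred a<) (sym e))
  ... | inj₂ refl | inj₁ b< = ⊥-elim (returnFree (injectiveUpTo n) (≤-pred b<) e)

  acyclic⇒¬nonBacktrackingWalk : ⊥
  acyclic⇒¬nonBacktrackingWalk = <⇒notInjective {f = vertex ∘ toℕ} ≤-refl
    (λ {x} {y} e → toℕ-injective (injectiveUpTo (size G) (toℕ≤pred[n] x) (toℕ≤pred[n] y) e))

ForwardNeighbour : (G : LGraph) → Fin (size G) → Fin (size G) → Set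
ForwardNeighbour G v u = adj G v u ≡ true × label G v ↝ label G u

Free : (G : LGraph) → Fin (size G) → Set
Free G v = ¬ (∃[ u ] ForwardNeighbour G v u)

forwardWalk : ∀ {G} → (∀ v → ∃[ u ] ForwardNeighbour G v u) → Fin (size G) → NonBacktrackingWalk G
forwardWalk {G} next v₀ = record
  { vertex = walk
  ; adjacent = λ k → proj₁ (proj₂ (next (walk k)))
  ; nonBacktracking = λ k → ↝-noReturn (forward k) (forward (suc k)) ∘ cong (label G)
  }
  where
  walk : ℕ → Fin (size G)
  walk zero = v₀
  walk (suc k) = proj₁ (next (walk k))
  forward : ∀ k → label G (walk k) ↝ label G (walk (suc k))
  forward k = proj₂ (proj₂ (next (walk k)))

acyclic⇒∃free : ∀ {G} → Acyclic G → Fin (size G) → ∃[ v ] Free G v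
acyclic⇒∃free {G} acyclic v₀ = ¬∀⟶∃¬ (size G) _ forwardNeighbour?
  (λ next → acyclic⇒¬nonBacktrackingWalk acyclic (forwardWalk next v₀))
  where
  forwardNeighbour? : ∀ v → Dec (∃[ u ] ForwardNeighbour G v u)
  forwardNeighbour? v = any? λ u → (adj G v u ≟ᵇ true) ×-dec
    ((label G u ≟ succ5 (label G v)) ⊎-dec (label G u ≟ succ5 (succ5 (label G v))))

module Pendant (G : LGraph) (v : Fin (size G)) (c : Fin 5) where

  edge : Fin (suc (size G)) → Fin (suc (size G)) → Bool
  edge zero    zero    = false
  edge zero    (suc j) = does (v ≟ j)
  edge (suc i) zero    = does (v ≟ i)
  edge (suc i) (suc j) = adj G i j

  edge-sym : ∀ i j → edge i j ≡ edge j i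
  edge-sym zero    zero    = refl
  edge-sym zero    (suc j) = refl
  edge-sym (suc i) zero    = refl
  edge-sym (suc i) (suc j) = symm G i j

  edge-irrefl : ∀ i → edge i i ≡ false
  edge-irrefl zero    = refl
  edge-irrefl (suc i) = irrefl G i

  colour : Fin (suc (size G)) → Fin 5
  colour zero    = c
  colour (suc i) = label G i

  graph : LGraph
  graph = record { size = suc (size G) ; adj = edge ; symm = edge-sym ; irrefl = edge-irrefl ; label = colour }

  inclusion : Emb G graph
  inclusion = record { map = suc ; inj = suc-injective ; adjP = λ _ _ → refl ; labP = λ _ → refl }

  attached : edge (suc v) zero ≡ true
  attached = dec-true (v ≟ v) refl

  leaf-neighbour : ∀ x → edge zero x ≡ true → x ≡ suc v
  leaf-neighbour (suc j) e = cong suc (sym (dec-true⁻¹ (v ≟ j) e))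

  preimage : ∀ (x : Fin (suc (size G))) → x ≢ zero → ∃[ y ] suc y ≡ x
  preimage zero    x≢0 = ⊥-elim (x≢0 refl)
  preimage (suc y) _   = y , refl

  acyclic : Acyclic G → Acyclic graph
  acyclic acyclicG C = acyclicG (cycle-pullback inclusion C λ i →
    preimage (Cycle.vert C i) (leaf-notOnCycle C zero unique i))
    where
    unique : ∀ u u′ → edge zero u ≡ true → edge zero u′ ≡ true → u ≡ u′
    unique u u′ eu eu′ = trans (leaf-neighbour u eu) (sym (leaf-neighbour u′ eu′))

  labelCond : LabelCond G → Free G v → LabelCond graph
  labelCond _ _ zero u w eu ew lu lw with leaf-neighbour u eu | leaf-neighbour w ew
  ... | refl | refl = succ5≢succ5² c (trans (sym lu) lw)
  labelCond _ _ (suc y) zero zero _ _ lu lw = succ5≢succ5² (label G y) (trans (sym lu) lw)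
  labelCond _ free (suc y) zero (suc w) eu ew _ lw with dec-true⁻¹ (v ≟ y) eu
  ... | refl = free (w , ew , inj₂ lw)
  labelCond _ free (suc y) (suc u) zero eu ew lu _ with dec-true⁻¹ (v ≟ y) ew
  ... | refl = free (u , eu , inj₁ lu)
  labelCond condG _ (suc y) (suc u) (suc w) = condG y u w

  inK : InK G → Free G v → InK graph
  inK (acyclicG , condG) free = acyclic acyclicG , labelCond condG free

pendant : (G : LGraph) → Fin (size G) → Fin 5 → LGraph
pendant = Pendant.graph

pendants-noAmalgam : ∀ {G} v {W} → LabelCond W →
  (f : Emb (pendant G v (succ5 (label G v))) W) →
  (g : Emb (pendant G v (succ5 (succ5 (label G v)))) W) →
  map f (suc v) ≡ map g (suc v) → ⊥
pendants-noAmalgam {G} v {W} condW f g f≡g =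
  condW (map f (suc v)) (map f zero) (map g zero)
    (trans (adjP f (suc v) zero) (Pendant.attached G v (succ5 (label G v))))
    (trans (cong (λ x → adj W x (map g zero)) f≡g)
           (trans (adjP g (suc v) zero) (Pendant.attached G v (succ5 (succ5 (label G v))))))
    (trans (labP f zero) (cong succ5 (sym centre)))
    (trans (labP g zero) (cong (succ5 ∘ succ5) (sym centre)))
  where
  centre : label W (map f (suc v)) ≡ label G v
  centre = labP f (suc v)

point : LGraph
point = record { size = 1 ; adj = λ _ _ → false ; symm = λ _ _ → refl ; irrefl = λ _ → refl ; label = λ _ → zero }

point-InK : InK point
point-InK = (λ C → 0≢1+n (Cycle.inj C {zero} {suc zero} (singleton _ _))) , λ _ _ _ ()
  where
  singleton : (a b : Fin 1) → a ≡ b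
  singleton zero zero = refl

mainTheorem2 : ¬ CAP InK
mainTheorem2 cap with cap point point-InK
... | Z′ , Z′∈𝒦 , ι , amalgamate with acyclic⇒∃free (proj₁ Z′∈𝒦) (map ι zero)
... | v , free with amalgamate (pendant Z′ v _) (pendant Z′ v _)
                       (Pendant.inK Z′ v _ Z′∈𝒦 free) (Pendant.inK Z′ v _ Z′∈𝒦 free)
                       (Pendant.inclusion Z′ v _) (Pendant.inclusion Z′ v _)
... | W , (_ , condW) , f , g , commute = pendants-noAmalgam v condW f g (commute v)
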